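{- Let $N$ be a net, let $P''$ be a finite GR-process of $N$ and $P$ a GR-process of $N$ with $P''\le P$, and let $\sigma\in\mathrm{Lin}(P)$. Then there are $\sigma''\in\mathrm{Lin}(P'')$ and $\sigma_1,\sigma_2\in\mathrm{FS}(N)$ with $\sigma''\le\sigma_1\equiv_0^*\sigma_2\le\sigma$.
   Context: A net is $N=(S,T,F,M_0)$ with $S,T$ disjoint, $F:(S\times T)\cup(T\times S)\to\mathbb{N}$, $M_0:S\to\mathbb{N}$, each transition having finitely many and at least one preplace and finitely many postplaces. ${}^\bullet x(y)=F(y,x)$, $x^\bullet(y)=F(x,y)$ (multisets), extended additively to finite multisets. For markings $M,M'$ and finite non-empty multiset $G$ of transitions, $M\xrightarrow{G}M'$ iff ${}^\bullet G\le M$ and $M'=(M-{}^\bullet G)+G^\bullet$. For a finite or infinite word $\sigma=t_1t_2\cdots$, $M\xrightarrow{\sigma}$ means $M\xrightarrow{\{t_1\}}M_1\xrightarrow{\{t_2\}}\cdots$. $\mathrm{FS}^\infty(N)$: words with $M_0\xrightarrow{\sigma}$; $\mathrm{FS}(N)$: finite ones. $\le$ on words is the prefix order. For $\sigma,\rho\in\mathrm{FS}^\infty(N)$, $\sigma\equiv_0\rho$ iff $\sigma=\alpha tu\beta$, $\rho=\alpha ut\beta$ and $M_0\xrightarrow{\alpha}M\xrightarrow{\{t,u\}}$ for some $M$; $\equiv_0^*$ is its reflexive transitive closure. A GR-process of $N$ is $P=(\mathcal N,\pi)$ where $\mathcal N=(\mathcal S,\mathcal T,\mathcal F,\mathcal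 M_0)$ is a net such that each place $s$ has $|{}^\bullet s|\le1\ge|s^\bullet|$ and $\mathcal M_0(s)=1$ if ${}^\bullet s=\emptyset$, else $0$; $\mathcal F^+$ (transitive closure of $\{(x,y)\mid\mathcal F(x,y)>0\}$) is irreflexive; each $u\in\mathcal T$ has finitely many $t$ with $(t,u)\in\mathcal F^+$; and $\pi$ maps places to places, transitions to transitions, with $M_0(s)=|\pi^{ -1}(s)\cap\mathcal M_0|$ and $F(s,\pi(t))=|\pi^{ -1}(s)\cap{}^\bullet t|$, $F(\pi(t),s)=|\pi^{ -1}(s)\cap t^\bullet|$ for all $t\in\mathcal T,s\in S$. Finite means $\mathcal T$ finite. $P'\le P$ (prefix) iff places and transitions of $P'$ are subsets of those of $P$, initial markings coincide, and flow and $\pi$ of $P'$ are the restrictions of those of $P$. $P$ with transitions $\mathcal T$ and $\sigma=t_0t_1\cdots\in\mathrm{FS}^\infty(N)$ are compatible iff there is a bijection $\mathrm{pos}:\mathcal T\to I$ ($I=\{0,\dots,|\sigma|-1\}$ if $\sigma$ finite, $I=\mathbb N$ otherwise) with $\pi(t)=t_{\mathrm{pos}(t)}$ and $(t,t')\in\mathcal F^+\Rightarrow\mathrm{pos}(t)<\mathrm{pos}(t')$. $\mathrm{Lin}(P)$ is the set of firing sequences compatible with $P$. -}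

module Defs where

open import Data.Nat using (ℕ; zero; suc; _+_; _∸_; _≤_; _<_)
open import Data.Fin using (Fin; toℕ)
open import Data.List using (List; []; _∷_; _++_; length; map)
open import Data.Nat.ListAction using (sum)
open import Data.List.Membership.Propositional using (_∈_)
open import Data.List.Relation.Unary.All using (All)
open import Data.List.Relation.Unary.Unique.Propositional using (Unique)
open import Data.Product using (Σ; ∃; _×_; _,_)
open import Data.Sum using (_⊎_; inj₁; inj₂)
open import Data.Empty using (⊥)
open import Data.Unit using (⊤)
open import Relation.Nullary using (¬_)
open import Relation.Binary.PropositionalEquality using (_≡_)
open import Relation.Binary.Construct.Closure.Transitive using (TransClosure)
open import Relation.Binary.Construct.Closure.ReflexiveTransitive using (Star)
open import Function.Definitions using (Bijective; Injective)

-- Multisets over a (possibly infinite) type A are functions A → ℕ.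
-- CardOn P m n : the multiset m restricted to the set P (i.e. P ∩ m) is
-- finite and has cardinality n (sum of multiplicities).

CardOn : {A : Set} → (A → Set) → (A → ℕ) → ℕ → Set
CardOn {A} P m n =
  Σ (List A) λ xs → Unique xs × All P xs
    × (∀ x → P x → 0 < m x → x ∈ xs) × sum (map m xs) ≡ n

AtMostOne : {A : Set} → (A → ℕ) → Set
AtMostOne m = Σ ℕ λ n → CardOn (λ _ → ⊤) m n × n ≤ 1

record Net : Set₁ where
  field
    S : Set
    T : Set
    F : (S × T) ⊎ (T × S) → ℕ
    M0 : S → ℕ
  Fst : S → T → ℕ
  Fst s t = F (inj₁ (s , t))
  Fts : T → S → ℕ
  Fts t s = F (inj₂ (t , s))
  field
    pre-finite  : ∀ t → Σ (List S) λ xs → ∀ s → 0 < Fst s t → s ∈ xs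
    pre-nonempty : ∀ t → ∃ λ s → 0 < Fst s t
    post-finite : ∀ t → Σ (List S) λ xs → ∀ s → 0 < Fts t s → s ∈ xs

  Marking : Set
  Marking = S → ℕ

  -- •G and G• for a finite multiset G of transitions (given as a list)
  preG : List T → S → ℕ
  preG G s = sum (map (Fst s) G)
  postG : List T → S → ℕ
  postG G s = sum (map (λ t → Fts t s) G)

  Step : Marking → List T → Marking → Set
  Step M G M' = (∀ s → preG G s ≤ M s)
              × (∀ s → M' s ≡ (M s ∸ preG G s) + postG G s)

  Reach : Marking → List T → Marking → Set
  Reach M [] M' = ∀ s → M s ≡ M' s
  Reach M (t ∷ ts) M' = Σ Marking λ M₁ → Step M (t ∷ []) M₁ × Reach M₁ ts M'

  Fires : Marking → List T → Set
  Fires M [] = ⊤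
  Fires M (t ∷ ts) = Σ Marking λ M₁ → Step M (t ∷ []) M₁ × Fires M₁ ts

  FiresInf : Marking → (ℕ → T) → Set
  FiresInf M f = Σ (ℕ → Marking) λ Ms → (∀ s → Ms 0 s ≡ M s)
                   × (∀ i → Step (Ms i) (f i ∷ []) (Ms (suc i)))

data Word (A : Set) : Set where
  fin : List A → Word A
  inf : (ℕ → A) → Word A

takeS : {A : Set} → (ℕ → A) → ℕ → List A
takeS f zero = []
takeS f (suc n) = f 0 ∷ takeS (λ i → f (suc i)) n

_++ʷ_ : {A : Set} → List A → Word A → Word A
xs ++ʷ fin ys = fin (xs ++ ys)
xs ++ʷ inf f = inf (go xs)
  where
  go : List _ → ℕ → _
  go [] i = f i
  go (x ∷ xs) zero = x
  go (x ∷ xs) (suc i) = go xs i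

_≼_ : {A : Set} → Word A → Word A → Set
fin xs ≼ fin ys = Σ (List _) λ zs → xs ++ zs ≡ ys
fin xs ≼ inf g = xs ≡ takeS g (length xs)
inf f ≼ fin ys = ⊥
inf f ≼ inf g = ∀ n → f n ≡ g n

Idx : {A : Set} → Word A → Set
Idx (fin xs) = Fin (length xs)
Idx (inf f) = ℕ

idxℕ : {A : Set} (w : Word A) → Idx w → ℕ
idxℕ (fin xs) i = toℕ i
idxℕ (inf f) i = i

at : {A : Set} (w : Word A) → Idx w → A
at (fin xs) i = Data.List.lookup xs i
at (inf f) i = f i

module _ (N : Net) where
  open Net N

  FSinf : Word T → Set
  FSinf (fin xs) = Fires M0 xs
  FSinf (inf f) = FiresInf M0 f

  FS : List T → Set
  FS xs = Fires M0 xs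

  Swap0 : Word T → Word T → Set
  Swap0 σ ρ = FSinf σ × FSinf ρ ×
    Σ (List T) λ α → Σ T λ t → Σ T λ u → Σ (Word T) λ β →
      σ ≡ (α ++ʷ ((t ∷ u ∷ []) ++ʷ β)) × ρ ≡ (α ++ʷ ((u ∷ t ∷ []) ++ʷ β)) ×
      Σ Marking λ M → Reach M0 α M × Σ Marking λ M' → Step M (t ∷ u ∷ []) M'

  Swap0* : Word T → Word T → Set
  Swap0* = Star Swap0

Edge : (𝒩 : Net) → Net.S 𝒩 ⊎ Net.T 𝒩 → Net.S 𝒩 ⊎ Net.T 𝒩 → Set
Edge 𝒩 (inj₁ s) (inj₂ t) = 0 < Net.Fst 𝒩 s t
Edge 𝒩 (inj₂ t) (inj₁ s) = 0 < Net.Fts 𝒩 t s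
Edge 𝒩 (inj₁ _) (inj₁ _) = ⊥
Edge 𝒩 (inj₂ _) (inj₂ _) = ⊥

Edge⁺ : (𝒩 : Net) → Net.S 𝒩 ⊎ Net.T 𝒩 → Net.S 𝒩 ⊎ Net.T 𝒩 → Set
Edge⁺ 𝒩 = TransClosure (Edge 𝒩)

record Process (N : Net) : Set₁ where
  field
    net : Net
  open Net net renaming (S to 𝒮; T to 𝒯; Fst to 𝓕st; Fts to 𝓕ts; M0 to 𝓜0) public
  field
    πS : 𝒮 → Net.S N
    πT : 𝒯 → Net.T N
    pre≤1  : ∀ s → AtMostOne (λ t → 𝓕ts t s)
    post≤1 : ∀ s → AtMostOne (λ t → 𝓕st s t)
    init : ∀ s → (𝓜0 s ≡ 1 × (∀ t → 𝓕ts t s ≡ 0))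
               ⊎ (𝓜0 s ≡ 0 × ¬ (∀ t → 𝓕ts t s ≡ 0))
    acyclic : ∀ x → ¬ Edge⁺ net x x
    finite-past : ∀ u → Σ (List 𝒯) λ ts → ∀ t → Edge⁺ net (inj₂ t) (inj₂ u) → t ∈ ts
    π-M0   : ∀ s → CardOn (λ s' → πS s' ≡ s) 𝓜0 (Net.M0 N s)
    π-pre  : ∀ t s → CardOn (λ s' → πS s' ≡ s) (λ s' → 𝓕st s' t) (Net.Fst N s (πT t))
    π-post : ∀ t s → CardOn (λ s' → πS s' ≡ s) (λ s' → 𝓕ts t s') (Net.Fts N (πT t) s)

module _ {N : Net} where
  open Process

  FiniteProcess : Process N → Set
  FiniteProcess P = Σ (List (𝒯 P)) λ ts → ∀ t → t ∈ ts

  -- P' ≤ P : P' is a prefix of P.  "Subset" is rendered by injective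
  -- inclusion maps ιS, ιT.
  record _≤P_ (P' P : Process N) : Set where
    field
      ιS : 𝒮 P' → 𝒮 P
      ιT : 𝒯 P' → 𝒯 P
      ιS-inj : Injective _≡_ _≡_ ιS
      ιT-inj : Injective _≡_ _≡_ ιT
      M0-restr : ∀ s → 𝓜0 P' s ≡ 𝓜0 P (ιS s)
      M0-incl  : ∀ s → 0 < 𝓜0 P s → Σ (𝒮 P') λ s' → ιS s' ≡ s
      Fst-restr : ∀ s t → 𝓕st P' s t ≡ 𝓕st P (ιS s) (ιT t)
      Fts-restr : ∀ t s → 𝓕ts P' t s ≡ 𝓕ts P (ιT t) (ιS s)
      πS-restr : ∀ s → πS P' s ≡ πS P (ιS s)
      πT-restr : ∀ t → πT P' t ≡ πT P (ιT t)

  Compatible : Process N → Word (Net.T N) → Set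
  Compatible P σ = Σ (𝒯 P → Idx σ) λ pos → Bijective _≡_ _≡_ pos
    × (∀ t → πT P t ≡ at σ (pos t))
    × (∀ t t' → Edge⁺ (net P) (inj₂ t) (inj₂ t') → idxℕ σ (pos t) < idxℕ σ (pos t'))

  Lin : Process N → Word (Net.T N) → Set
  Lin P σ = FSinf N σ × Compatible P σ

-- Cut σ after a finite prefix τ containing every event of P''. Then sort τ stably so that
-- the events of P'' come first, using only adjacent transpositions that move an event of
-- P'' in front of an event outside P''. As P'' is causally closed in P, the second event
-- never produces a condition the first one consumes, so both are enabled concurrently:
-- along a run of P the π-image of the current cut is bounded by the current marking of N,
-- and the presets of the two events are disjoint parts of that cut. Hence every
-- transposition is a ≡₀-step, and the P''-part of the sorted sequence linearises P''.
module Submission where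

open import Defs
open import Data.Empty using (⊥-elim)
open import Data.Fin using (Fin; zero; suc; toℕ; fromℕ<)
open import Data.Fin.Properties using (toℕ-injective; toℕ<n; toℕ-fromℕ<)
  renaming (suc-injective to Fin-suc-injective)
open import Data.List
  using (List; []; _∷_; _++_; _ʳ++_; [_]; length; map; filter; tabulate; lookup; reverse)
open import Data.List.Properties
  using (ʳ++-defn; ++-identityʳ; length-++; map-++; map-∘; map-cong; map-tabulate; tabulate-cong;
         tabulate-lookup; filter-accept; filter-reject)
open import Data.List.Membership.Propositional using (_∈_; _∉_; lose)
open import Data.List.Membership.Propositional.Properties
  using (∈-tabulate⁺; ∈-tabulate⁻; ∈-map⁺; ∈-map⁻; ∈-filter⁺)
open import Data.List.Membership.Propositional.Properties.WithK using (unique⇒irrelevant)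
open import Data.List.Relation.Binary.Subset.Propositional using (_⊆_)
open import Data.List.Relation.Unary.All as All using (All; []; _∷_)
import Data.List.Relation.Unary.All.Properties as All
open import Data.List.Relation.Unary.AllPairs as AllPairs using (AllPairs; []; _∷_)
import Data.List.Relation.Unary.AllPairs.Properties as AllPairs
open import Data.List.Relation.Unary.Any as Any using (here; there; _─_; any?)
open import Data.List.Relation.Unary.Unique.Propositional using (Unique)
open import Data.List.Relation.Unary.Unique.Propositional.Properties using (filter⁺; ++⁺; map⁺)
open import Data.Nat using (ℕ; zero; suc; _+_; _∸_; _≤_; _<_; z≤n; s≤s; z<s; _<?_)
  renaming (_≟_ to _≟ℕ_)
open import Data.Nat.ListAction using (sum)
open import Data.Nat.Properties hiding (_≟_)
open import Data.Product using (Σ; ∃; _×_; _,_; proj₁; proj₂)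
open import Data.Sum as Sum using (_⊎_; inj₁; inj₂)
open import Data.Unit using (⊤; tt)
open import Function using (_∘_; id)
open import Level using (0ℓ)
open import Relation.Binary.Construct.Closure.ReflexiveTransitive using (ε; _◅_; _◅◅_)
open import Relation.Binary.Construct.Closure.Transitive using (_∷_) renaming ([_] to [_]⁺)
open import Relation.Binary.Definitions using (DecidableEquality)
open import Relation.Binary.PropositionalEquality hiding ([_])
open import Relation.Nullary using (¬_; yes; no)
open import Relation.Nullary.Decidable using (map′; decidable-stable)
open import Relation.Unary using (Pred; Decidable)
open import Relation.Unary.Properties using (∁?)

open import Algebra.Properties.CommutativeSemigroup +-commutativeSemigroup
  using (x∙yz≈y∙xz; xy∙z≈xz∙y)

module _ {A : Set} where

  ∈-─ : ∀ {x y} {xs : List A} (x∈xs : x ∈ xs) → y ∈ xs → y ≢ x → y ∈ (xs ─ x∈xs)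
  ∈-─ (here refl) (here refl) y≢x = ⊥-elim (y≢x refl)
  ∈-─ (here _)    (there y∈xs) _  = y∈xs
  ∈-─ (there _)   (here refl)  _  = here refl
  ∈-─ (there x∈xs) (there y∈xs) y≢x = there (∈-─ x∈xs y∈xs y≢x)

  Unique-─ : ∀ {x} {xs : List A} → Unique xs → (x∈xs : x ∈ xs) → Unique (xs ─ x∈xs)
  Unique-─ (_ ∷ u) (here _)    = u
  Unique-─ (h ∷ u) (there x∈xs) = All.─⁺ x∈xs h ∷ Unique-─ u x∈xs

  length-filter-∁ : ∀ {P : Pred A 0ℓ} (P? : Decidable P) xs →
                    length (filter P? xs) + length (filter (∁? P?) xs) ≡ length xs
  length-filter-∁ P? [] = refl
  length-filter-∁ P? (x ∷ xs) with P? x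
  ... | yes _ = cong suc (length-filter-∁ P? xs)
  ... | no _  = trans (+-suc _ _) (cong suc (length-filter-∁ P? xs))

≮0⇒≡0 : ∀ {n} → ¬ 0 < n → n ≡ 0
≮0⇒≡0 = n≤0⇒n≡0 ∘ ≮⇒≥

module _ {A : Set} (f : A → ℕ) where

  sum-─ : ∀ {x} {xs : List A} (x∈xs : x ∈ xs) → sum (map f xs) ≡ f x + sum (map f (xs ─ x∈xs))
  sum-─ (here refl) = refl
  sum-─ {x} {y ∷ _} (there x∈xs) =
    trans (cong (f y +_) (sum-─ x∈xs)) (x∙yz≈y∙xz (f y) (f x) _)

  sum-mono-⊆ : ∀ {xs ys : List A} → Unique xs → Unique ys →
               (∀ {x} → x ∈ xs → 0 < f x → x ∈ ys) → sum (map f xs) ≤ sum (map f ys)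
  sum-mono-⊆ {[]} _ _ _ = z≤n
  sum-mono-⊆ {x ∷ xs} {ys} (x∉xs ∷ xs!) ys! xs⊆ys with f x in fx
  ... | zero = sum-mono-⊆ xs! ys! (xs⊆ys ∘ there)
  ... | suc k = begin
      suc k + sum (map f xs)            ≤⟨ +-monoʳ-≤ (suc k) (sum-mono-⊆ xs! ys─x! xs⊆ys─x) ⟩
      suc k + sum (map f (ys ─ x∈ys))   ≡⟨ cong (_+ sum (map f (ys ─ x∈ys))) fx ⟨
      f x + sum (map f (ys ─ x∈ys))     ≡⟨ sum-─ x∈ys ⟨
      sum (map f ys)                    ∎
    where
    open ≤-Reasoning
    x∈ys : x ∈ ys
    x∈ys = xs⊆ys (here refl) (subst (0 <_) (sym fx) z<s)
    ys─x! : Unique (ys ─ x∈ys)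
    ys─x! = Unique-─ ys! x∈ys
    xs⊆ys─x : ∀ {y} → y ∈ xs → 0 < f y → y ∈ (ys ─ x∈ys)
    xs⊆ys─x y∈xs fy =
      ∈-─ x∈ys (xs⊆ys (there y∈xs) fy) λ { refl → All.lookup x∉xs y∈xs refl }

  length≤sum : ∀ {xs} → All (λ x → 0 < f x) xs → length xs ≤ sum (map f xs)
  length≤sum [] = z≤n
  length≤sum (fx ∷ fxs) = +-mono-≤ fx (length≤sum fxs)

  sum≤length : (∀ x → f x ≤ 1) → ∀ xs → sum (map f xs) ≤ length xs
  sum≤length f≤1 [] = z≤n
  sum≤length f≤1 (x ∷ xs) = +-mono-≤ (f≤1 x) (sum≤length f≤1 xs)

  positive? : Decidable (λ x → 0 < f x)
  positive? x = 0 <? f x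

  sum-filter-positive : ∀ xs → sum (map f (filter positive? xs)) ≡ sum (map f xs)
  sum-filter-positive [] = refl
  sum-filter-positive (x ∷ xs) with positive? x
  ... | yes fx = trans (cong (sum ∘ map f) (filter-accept positive? fx))
                       (cong (f x +_) (sum-filter-positive xs))
  ... | no ¬fx = trans (cong (sum ∘ map f) (filter-reject positive? ¬fx))
                       (trans (sum-filter-positive xs) (cong (_+ sum (map f xs)) (sym (≮0⇒≡0 ¬fx))))

  positive-witness : ∀ xs → (∀ x → 0 < f x → x ∈ xs) → ¬ (∀ x → f x ≡ 0) →
                     ∃ λ x → 0 < f x
  positive-witness xs covers f≢0 with any? positive? xs
  ... | yes found = Any.satisfied found
  ... | no none = ⊥-elim (f≢0 λ x → ≮0⇒≡0 λ fx → none (lose (covers x fx) fx))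

takeS-tabulate : ∀ {A : Set} (f : ℕ → A) n → takeS f n ≡ tabulate (f ∘ toℕ {n})
takeS-tabulate f zero = refl
takeS-tabulate f (suc n) = cong (f 0 ∷_) (takeS-tabulate (f ∘ suc) n)

length-takeS : ∀ {A : Set} (f : ℕ → A) n → length (takeS f n) ≡ n
length-takeS f zero = refl
length-takeS f (suc n) = cong suc (length-takeS (f ∘ suc) n)

takeS-≼ : ∀ {A : Set} (f : ℕ → A) n → fin (takeS f n) ≼ inf f
takeS-≼ f n = cong (takeS f) (sym (length-takeS f n))

module _ {A B : Set} (g : A → B) where

  mapIndex : ∀ {x xs} → x ∈ xs → Fin (length (map g xs))
  mapIndex (here _)     = zero
  mapIndex (there x∈xs) = suc (mapIndex x∈xs)

  lookup-mapIndex : ∀ {x xs} (x∈xs : x ∈ xs) → lookup (map g xs) (mapIndex x∈xs) ≡ g x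
  lookup-mapIndex (here refl)  = refl
  lookup-mapIndex (there x∈xs) = lookup-mapIndex x∈xs

  mapIndex-injective : ∀ {x y xs} (x∈xs : x ∈ xs) (y∈xs : y ∈ xs) →
                       mapIndex x∈xs ≡ mapIndex y∈xs → x ≡ y
  mapIndex-injective (here refl)  (here refl)  _  = refl
  mapIndex-injective (there x∈xs) (there y∈xs) eq =
    mapIndex-injective x∈xs y∈xs (Fin-suc-injective eq)

  mapIndex-surjective : ∀ {xs} (i : Fin (length (map g xs))) →
                        ∃ λ x → Σ (x ∈ xs) λ x∈xs → mapIndex x∈xs ≡ i
  mapIndex-surjective {_ ∷ _}  zero    = _ , here refl , refl
  mapIndex-surjective {_ ∷ xs} (suc i) =
    let x , x∈xs , eq = mapIndex-surjective {xs} i in x , there x∈xs , cong suc eq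

  mapIndex-monotone : ∀ (key : A → ℕ) {x y xs} → AllPairs (λ a b → key a < key b) xs →
    (x∈xs : x ∈ xs) (y∈xs : y ∈ xs) → key x < key y →
    toℕ (mapIndex x∈xs) < toℕ (mapIndex y∈xs)
  mapIndex-monotone key _ (here refl) (here refl) x<y = ⊥-elim (<-irrefl refl x<y)
  mapIndex-monotone key _ (here refl) (there _) _ = z<s
  mapIndex-monotone key (x< ∷ _) (there x∈xs) (here refl) x<y =
    ⊥-elim (<-asym x<y (All.lookup x< x∈xs))
  mapIndex-monotone key (_ ∷ sorted) (there x∈xs) (there y∈xs) x<y =
    s≤s (mapIndex-monotone key sorted x∈xs y∈xs x<y)

idxℕ-injective : ∀ {A : Set} (w : Word A) {i j : Idx w} → idxℕ w i ≡ idxℕ w j → i ≡ j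
idxℕ-injective (fin _) = toℕ-injective
idxℕ-injective (inf _) = id

strict-upper-bound : ∀ {A : Set} (f : A → ℕ) xs → ∃ λ n → All (λ x → f x < n) xs
strict-upper-bound f [] = 0 , []
strict-upper-bound f (x ∷ xs) =
  let n , xs<n = strict-upper-bound f xs
  in suc (f x) + n ,
     s≤s (m≤m+n (f x) n) ∷ All.map (λ fy<n → <-≤-trans fy<n (m≤n+m n (suc (f x)))) xs<n

module _ {A : Set} {P : A → Set} {m : A → ℕ} {n : ℕ} (card : CardOn P m n) where

  CardOn⇒sum≤ : ∀ {xs} → Unique xs → All P xs → sum (map m xs) ≤ n
  CardOn⇒sum≤ xs! Pxs = let ys , ys! , _ , covers , ∑ys≡n = card in
    subst (_ ≤_) ∑ys≡n (sum-mono-⊆ m xs! ys! λ x∈xs → covers _ (All.lookup Pxs x∈xs))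

  CardOn⇒length≤ : ∀ {xs} → Unique xs → All P xs → All (λ x → 0 < m x) xs → length xs ≤ n
  CardOn⇒length≤ xs! Pxs mxs = ≤-trans (length≤sum m mxs) (CardOn⇒sum≤ xs! Pxs)

  CardOn⇒support : (∀ x → m x ≤ 1) →
    Σ (List A) λ xs → Unique xs × All P xs × All (λ x → 0 < m x) xs × n ≤ length xs
  CardOn⇒support m≤1 = let ys , ys! , Pys , _ , ∑ys≡n = card in
    filter (positive? m) ys , filter⁺ (positive? m) ys! , All.filter⁺ (positive? m) Pys ,
    All.all-filter (positive? m) ys ,
    subst (_≤ _) (trans (sum-filter-positive m ys) ∑ys≡n)
          (sum≤length m m≤1 (filter (positive? m) ys))

module _ {A : Set} {m : A → ℕ} (one : AtMostOne m) where

  AtMostOne⇒≤1 : ∀ a → m a ≤ 1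
  AtMostOne⇒≤1 a = let _ , card , n≤1 = one in
    ≤-trans (m≤m+n (m a) 0) (≤-trans (CardOn⇒sum≤ card ([] ∷ []) (tt ∷ [])) n≤1)

  AtMostOne⇒¬≢ : ∀ {a b} → 0 < m a → 0 < m b → ¬ a ≢ b
  AtMostOne⇒¬≢ {a} {b} ma mb a≢b = let _ , card , n≤1 = one in
    <-irrefl refl (≤-trans (CardOn⇒length≤ card ab! (tt ∷ tt ∷ []) (ma ∷ mb ∷ [])) n≤1)
    where
    ab! : Unique (a ∷ b ∷ [])
    ab! = (a≢b ∷ []) ∷ [] ∷ []

  AtMostOne⇒witness : ¬ (∀ a → m a ≡ 0) → ∃ λ a → 0 < m a
  AtMostOne⇒witness = let _ , (xs , _ , _ , covers , _) , _ = one in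
    positive-witness m xs λ a → covers a tt

∸-+-interchange : ∀ {m} p q w r → p + q ≤ m → (m ∸ q + w ∸ p) + r ≡ (m ∸ p + r ∸ q) + w
∸-+-interchange {m} p q w r p+q≤m = begin
  (m ∸ q + w ∸ p) + r   ≡⟨ cong (_+ r) (+-∸-comm w (m+n≤o⇒m≤o∸n p p+q≤m)) ⟩
  (m ∸ q ∸ p + w) + r   ≡⟨ xy∙z≈xz∙y (m ∸ q ∸ p) w r ⟩
  (m ∸ q ∸ p + r) + w   ≡⟨ cong (λ k → k + r + w) ∸-comm ⟩
  (m ∸ p ∸ q + r) + w   ≡⟨ cong (_+ w) (+-∸-comm r q≤m∸p) ⟨
  (m ∸ p + r ∸ q) + w   ∎
  where
  open ≡-Reasoning
  q≤m∸p : q ≤ m ∸ p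
  q≤m∸p = m+n≤o⇒m≤o∸n q (subst (_≤ m) (+-comm p q) p+q≤m)
  ∸-comm : m ∸ q ∸ p ≡ m ∸ p ∸ q
  ∸-comm = trans (∸-+-assoc m q p) (trans (cong (m ∸_) (+-comm q p)) (sym (∸-+-assoc m p q)))

module Firing (N : Net) where
  open Net N

  _≗ᴹ_ : Marking → Marking → Set
  M ≗ᴹ M' = ∀ s → M s ≡ M' s

  Step-respˡ : ∀ {M M' M'' G} → M ≗ᴹ M' → Step M' G M'' → Step M G M''
  Step-respˡ {G = G} M≗M' (enabled , M''≡) =
    (λ s → subst (preG G s ≤_) (sym (M≗M' s)) (enabled s)) ,
    (λ s → trans (M''≡ s) (cong (λ k → k ∸ preG G s + postG G s) (sym (M≗M' s))))

  Fires-respˡ : ∀ {M M'} xs → M ≗ᴹ M' → Fires M' xs → Fires M xs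
  Fires-respˡ [] _ _ = tt
  Fires-respˡ (x ∷ _) M≗M' (M₁ , step , fires) = M₁ , Step-respˡ {G = [ x ]} M≗M' step , fires

  Fires-++⁻ : ∀ {M} xs {ys} → Fires M (xs ++ ys) → Σ Marking λ M' → Reach M xs M' × Fires M' ys
  Fires-++⁻ [] fires = _ , (λ _ → refl) , fires
  Fires-++⁻ (_ ∷ xs) (M₁ , step , fires) =
    let M' , reach , fires' = Fires-++⁻ xs fires in M' , (M₁ , step , reach) , fires'

  Fires-++⁺ : ∀ {M M'} xs {ys} → Reach M xs M' → Fires M' ys → Fires M (xs ++ ys)
  Fires-++⁺ [] M≗M' fires = Fires-respˡ _ M≗M' fires
  Fires-++⁺ (_ ∷ xs) (M₁ , step , reach) fires = M₁ , step , Fires-++⁺ xs reach fires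

  Fires-++⁻ˡ : ∀ {M} xs {ys} → Fires M (xs ++ ys) → Fires M xs
  Fires-++⁻ˡ xs fires = let _ , reach , _ = Fires-++⁻ xs fires in Reach⇒Fires xs reach
    where
    Reach⇒Fires : ∀ {M M'} xs → Reach M xs M' → Fires M xs
    Reach⇒Fires [] _ = tt
    Reach⇒Fires (_ ∷ xs) (M₁ , step , reach) = M₁ , step , Reach⇒Fires xs reach

  FiresInf⇒Fires-takeS : ∀ {M f} → FiresInf M f → ∀ n → Fires M (takeS f n)
  FiresInf⇒Fires-takeS _ zero = tt
  FiresInf⇒Fires-takeS {f = f} (Ms , Ms0≗M , steps) (suc n) =
    Ms 1 , Step-respˡ {G = [ f 0 ]} (λ s → sym (Ms0≗M s)) (steps 0) ,
    FiresInf⇒Fires-takeS (Ms ∘ suc , (λ _ → refl) , steps ∘ suc) n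

  fire : Marking → T → Marking
  fire M t s = M s ∸ Fst s t + Fts t s

  single-Step-fire : ∀ M t s → M s ∸ preG [ t ] s + postG [ t ] s ≡ fire M t s
  single-Step-fire M t s =
    cong₂ (λ k l → M s ∸ k + l) (+-identityʳ (Fst s t)) (+-identityʳ (Fts t s))

  Step⇒fire : ∀ {M t M'} → Step M [ t ] M' → M' ≗ᴹ fire M t
  Step⇒fire {M} {t} (_ , M'≡) s = trans (M'≡ s) (single-Step-fire M t s)

  fire-Step : ∀ {M t} → (∀ s → Fst s t ≤ M s) → Step M [ t ] (fire M t)
  fire-Step {M} {t} enabled =
    (λ s → subst (_≤ M s) (sym (+-identityʳ (Fst s t))) (enabled s)) ,
    (λ s → sym (single-Step-fire M t s))

  swap-concurrent : ∀ α t u β → FS N (α ++ t ∷ u ∷ β) →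
    (∀ {M} → Reach M0 α M → ∀ s → Fst s t + Fst s u ≤ M s) →
    Swap0 N (fin (α ++ u ∷ t ∷ β)) (fin (α ++ t ∷ u ∷ β))
  swap-concurrent α t u β fires concurrent
    with M , α-reach , M₁ , t-step , M₂ , u-step , β-fires ← Fires-++⁻ α fires =
    Fires-++⁺ α α-reach (fire M u , fire-Step u-enabled , _ , fire-Step t-enabled ,
                         Fires-respˡ β ut≗tu β-fires) ,
    fires , α , u , t , fin β , refl , refl , M , α-reach , _ , (both-enabled , λ _ → refl)
    where
    u-enabled : ∀ s → Fst s u ≤ M s
    u-enabled s = ≤-trans (m≤n+m (Fst s u) (Fst s t)) (concurrent α-reach s)
    t-enabled : ∀ s → Fst s t ≤ fire M u s
    t-enabled s = ≤-trans (m+n≤o⇒m≤o∸n (Fst s t) (concurrent α-reach s)) (m≤m+n _ (Fts u s))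
    both-enabled : ∀ s → preG (u ∷ t ∷ []) s ≤ M s
    both-enabled s = subst (_≤ M s)
      (trans (+-comm (Fst s t) (Fst s u)) (cong (Fst s u +_) (sym (+-identityʳ (Fst s t)))))
      (concurrent α-reach s)
    ut≗tu : fire (fire M u) t ≗ᴹ M₂
    ut≗tu s = begin
      fire (fire M u) t s
        ≡⟨ ∸-+-interchange (Fst s t) (Fst s u) (Fts u s) (Fts t s) (concurrent α-reach s) ⟩
      fire M t s ∸ Fst s u + Fts u s
        ≡⟨ cong (λ k → k ∸ Fst s u + Fts u s) (Step⇒fire t-step s) ⟨
      M₁ s ∸ Fst s u + Fts u s
        ≡⟨ Step⇒fire u-step s ⟨
      M₂ s ∎
      where open ≡-Reasoning

module Causality {N : Net} (P : Process N) where
  open Net N using (S; Fst; Fts; Marking; Step; Reach; M0)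
  open Process P
    using (𝒮; 𝒯; 𝓕st; 𝓕ts; 𝓜0; πS; πT; pre≤1; post≤1; init; π-M0; π-pre; π-post)
  open Firing N using (Step⇒fire; swap-concurrent)

  initial-or-produced : ∀ p → 0 < 𝓜0 p ⊎ ∃ λ y → 0 < 𝓕ts y p
  initial-or-produced p with init p
  ... | inj₁ (M0≡1 , _)     = inj₁ (subst (0 <_) (sym M0≡1) z<s)
  ... | inj₂ (_ , produced) = inj₂ (AtMostOne⇒witness (pre≤1 p) produced)

  initial-unproduced : ∀ {p} y → 0 < 𝓜0 p → 𝓕ts y p ≡ 0
  initial-unproduced {p} y marked with init p
  ... | inj₁ (_ , unproduced) = unproduced y
  ... | inj₂ (M0≡0 , _)       = ⊥-elim (<-irrefl (sym M0≡0) marked)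

  Feeds : 𝒯 → 𝒯 → Set
  Feeds x y = ∃ λ p → 0 < 𝓕ts x p × 0 < 𝓕st p y

  Produced : List 𝒯 → 𝒮 → Set
  Produced γ p = 0 < 𝓜0 p ⊎ ∃ λ y → y ∈ γ × 0 < 𝓕ts y p

  InCut : List 𝒯 → 𝒮 → Set
  InCut γ p = Produced γ p × (∀ y → y ∈ γ → 𝓕st p y ≡ 0)

  Ready : List 𝒯 → 𝒯 → Set
  Ready γ x = ∀ p → 0 < 𝓕st p x → Produced γ p

  Run : List 𝒯 → List 𝒯 → Set
  Run γ []      = ⊤
  Run γ (x ∷ τ) = x ∉ γ × Ready γ x × Run (x ∷ γ) τ

  -- π(cut reached by γ) ≤ M, as multisets of places of N.
  CutBelow : List 𝒯 → Marking → Set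
  CutBelow γ M = ∀ s {ps} → Unique ps → All (λ p → πS p ≡ s) ps → All (InCut γ) ps →
                 length ps ≤ M s

  preset : ∀ x s → Σ (List 𝒮) λ ps → Unique ps × All (λ p → πS p ≡ s) ps ×
                   All (λ p → 0 < 𝓕st p x) ps × Fst s (πT x) ≤ length ps
  preset x s = CardOn⇒support (π-pre x s) λ p → AtMostOne⇒≤1 (post≤1 p) x

  preset-InCut : ∀ {γ x p} → x ∉ γ → Ready γ x → 0 < 𝓕st p x → InCut γ p
  preset-InCut {p = p} x∉γ ready px =
    ready p px ,
    λ y y∈γ → ≮0⇒≡0 λ py → AtMostOne⇒¬≢ (post≤1 p) px py λ { refl → x∉γ y∈γ }

  CutBelow-initial : CutBelow [] M0
  CutBelow-initial s ps! πps cut = CardOn⇒length≤ (π-M0 s) ps! πps (All.map initially-marked cut)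
    where
    initially-marked : ∀ {p} → InCut [] p → 0 < 𝓜0 p
    initially-marked (inj₁ marked , _) = marked
    initially-marked (inj₂ (_ , () , _) , _)

  CutBelow-fire : ∀ {γ x M M'} → CutBelow γ M → x ∉ γ → Ready γ x → Step M [ πT x ] M' →
                  CutBelow (x ∷ γ) M'
  CutBelow-fire {γ} {x} {M} {M'} below x∉γ ready step s {ps} ps! πps cut = begin
    length ps                                ≡⟨ length-filter-∁ fed? ps ⟨
    length fed + length unfed                ≤⟨ +-mono-≤ fed≤post unfed≤rest ⟩
    Fts (πT x) s + (M s ∸ Fst s (πT x))      ≡⟨ +-comm (Fts (πT x) s) _ ⟩
    M s ∸ Fst s (πT x) + Fts (πT x) s        ≡⟨ Step⇒fire step s ⟨
    M' s                                     ∎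
    where
    open ≤-Reasoning
    fed? : Decidable (λ p → 0 < 𝓕ts x p)
    fed? = positive? (𝓕ts x)
    fed unfed : List 𝒮
    fed = filter fed? ps
    unfed = filter (∁? fed?) ps

    fed≤post : length fed ≤ Fts (πT x) s
    fed≤post =
      CardOn⇒length≤ (π-post x s) (filter⁺ fed? ps!) (All.filter⁺ fed? πps) (All.all-filter fed? ps)

    earlier : ∀ {p} → InCut (x ∷ γ) p × ¬ 0 < 𝓕ts x p → InCut γ p
    earlier ((inj₁ marked , unconsumed) , _) = inj₁ marked , λ y → unconsumed y ∘ there
    earlier ((inj₂ (_ , here refl , xp) , _) , ¬xp) = ⊥-elim (¬xp xp)
    earlier ((inj₂ (y , there y∈γ , yp) , unconsumed) , _) =
      inj₂ (y , y∈γ , yp) , λ z → unconsumed z ∘ there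

    unfed≤rest : length unfed ≤ M s ∸ Fst s (πT x)
    unfed≤rest with pre , pre! , πpre , pre-consumed , Fst≤pre ← preset x s =
      m+n≤o⇒m≤o∸n (length unfed) (begin
        length unfed + Fst s (πT x)       ≤⟨ +-monoʳ-≤ (length unfed) Fst≤pre ⟩
        length unfed + length pre         ≡⟨ length-++ unfed ⟨
        length (unfed ++ pre)             ≤⟨ below s (++⁺ (filter⁺ _ ps!) pre! disjoint)
                                                 (All.++⁺ (All.filter⁺ _ πps) πpre)
                                                 (All.++⁺ unfed-InCut pre-InCut) ⟩
        M s                               ∎)
      where
      unfed-InCut : All (InCut γ) unfed
      unfed-InCut = All.map earlier (All.zip (All.filter⁺ _ cut , All.all-filter _ ps))
      pre-InCut : All (InCut γ) pre
      pre-InCut = All.map (preset-InCut x∉γ ready) pre-consumed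
      disjoint : ∀ {p} → ¬ (p ∈ unfed × p ∈ pre)
      disjoint (p∈unfed , p∈pre) = <-irrefl
        (sym (proj₂ (All.lookup (All.filter⁺ _ cut) p∈unfed) x (here refl)))
        (All.lookup pre-consumed p∈pre)

  CutBelow-run : ∀ {γ M M'} α → CutBelow γ M → Run γ α → Reach M (map πT α) M' →
                 CutBelow (α ʳ++ γ) M'
  CutBelow-run [] below _ M≗M' s ps! πps cut = subst (_ ≤_) (M≗M' s) (below s ps! πps cut)
  CutBelow-run (x ∷ α) below (x∉γ , ready , run) (_ , step , reach) =
    CutBelow-run α (CutBelow-fire below x∉γ ready step) run reach

  ready-concurrent : ∀ {γ M x y} → CutBelow γ M → x ∉ γ → Ready γ x → y ∉ γ → Ready γ y →
                     x ≢ y → ∀ s → Fst s (πT x) + Fst s (πT y) ≤ M s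
  ready-concurrent {M = M} {x} {y} below x∉γ x-ready y∉γ y-ready x≢y s
    with xs , xs! , πxs , x-consumes , Fst≤xs ← preset x s
       | ys , ys! , πys , y-consumes , Fst≤ys ← preset y s = begin
    Fst s (πT x) + Fst s (πT y)   ≤⟨ +-mono-≤ Fst≤xs Fst≤ys ⟩
    length xs + length ys         ≡⟨ length-++ xs ⟨
    length (xs ++ ys)             ≤⟨ below s (++⁺ xs! ys! disjoint) (All.++⁺ πxs πys)
                                        (All.++⁺ (All.map (preset-InCut x∉γ x-ready) x-consumes)
                                                 (All.map (preset-InCut y∉γ y-ready) y-consumes)) ⟩
    M s                           ∎
    where
    open ≤-Reasoning
    disjoint : ∀ {p} → ¬ (p ∈ xs × p ∈ ys)
    disjoint {p} (p∈xs , p∈ys) =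
      AtMostOne⇒¬≢ (post≤1 p) (All.lookup x-consumes p∈xs) (All.lookup y-consumes p∈ys) x≢y

  Ready-mono : ∀ {γ δ x} → γ ⊆ δ → Ready γ x → Ready δ x
  Ready-mono γ⊆δ ready p px with ready p px
  ... | inj₁ marked = inj₁ marked
  ... | inj₂ (y , y∈γ , yp) = inj₂ (y , γ⊆δ y∈γ , yp)

  Ready-skip : ∀ {δ x y} → ¬ Feeds x y → Ready (x ∷ δ) y → Ready δ y
  Ready-skip ¬feeds ready p py with ready p py
  ... | inj₁ marked = inj₁ marked
  ... | inj₂ (_ , here refl , xp) = ⊥-elim (¬feeds (p , xp , py))
  ... | inj₂ (z , there z∈δ , zp) = inj₂ (z , z∈δ , zp)

  Run-resp : ∀ {γ δ} τ → γ ⊆ δ → δ ⊆ γ → Run γ τ → Run δ τ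
  Run-resp [] _ _ _ = tt
  Run-resp (x ∷ τ) γ⊆δ δ⊆γ (x∉γ , ready , run) =
    x∉γ ∘ δ⊆γ , Ready-mono γ⊆δ ready , Run-resp τ (∷⁺ γ⊆δ) (∷⁺ δ⊆γ) run
    where
    ∷⁺ : ∀ {xs ys} → xs ⊆ ys → x ∷ xs ⊆ x ∷ ys
    ∷⁺ xs⊆ys (here refl) = here refl
    ∷⁺ xs⊆ys (there p) = there (xs⊆ys p)

  Run-++⁻ : ∀ {γ} α {τ} → Run γ (α ++ τ) → Run γ α × Run (α ʳ++ γ) τ
  Run-++⁻ [] run = tt , run
  Run-++⁻ (x ∷ α) (x∉γ , ready , run) =
    let runα , runτ = Run-++⁻ α run in (x∉γ , ready , runα) , runτ

  Run-++⁺ : ∀ {γ} α {τ} → Run γ α → Run (α ʳ++ γ) τ → Run γ (α ++ τ)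
  Run-++⁺ [] _ run = run
  Run-++⁺ (x ∷ α) (x∉γ , ready , runα) runτ = x∉γ , ready , Run-++⁺ α runα runτ

  Run-swap : ∀ {γ} α x y β → Run γ (α ++ x ∷ y ∷ β) → ¬ Feeds x y →
             Run γ (α ++ y ∷ x ∷ β)
  Run-swap α x y β run ¬feeds
    with runα , (x∉δ , x-ready , y∉xδ , y-ready , runβ) ← Run-++⁻ α run =
    Run-++⁺ α runα (y∉xδ ∘ there , Ready-skip ¬feeds y-ready , x∉yδ , Ready-mono there x-ready ,
                    Run-resp β swap swap runβ)
    where
    x∉yδ : x ∉ y ∷ α ʳ++ _
    x∉yδ (here refl) = y∉xδ (here refl)
    x∉yδ (there x∈δ) = x∉δ x∈δ
    swap : ∀ {u v δ} → u ∷ v ∷ δ ⊆ v ∷ u ∷ δ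
    swap (here refl) = there (here refl)
    swap (there (here refl)) = here refl
    swap (there (there p)) = there (there p)

  swap-independent : ∀ α x y β → Run [] (α ++ x ∷ y ∷ β) → FS N (map πT (α ++ x ∷ y ∷ β)) →
    ¬ Feeds x y →
    Run [] (α ++ y ∷ x ∷ β) ×
    Swap0 N (fin (map πT (α ++ y ∷ x ∷ β))) (fin (map πT (α ++ x ∷ y ∷ β)))
  swap-independent α x y β run fires ¬feeds =
    Run-swap α x y β run ¬feeds ,
    subst₂ (Swap0 N) (cong fin (sym (map-++ πT α _))) (cong fin (sym (map-++ πT α _)))
      (swap-concurrent (map πT α) (πT x) (πT y) (map πT β)
                       (subst (FS N) (map-++ πT α _) fires) concurrent)
    where
    concurrent : ∀ {M} → Reach M0 (map πT α) M → ∀ s → Fst s (πT x) + Fst s (πT y) ≤ M s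
    concurrent reach with runα , (x∉δ , x-ready , y∉xδ , y-ready , _) ← Run-++⁻ α run =
      ready-concurrent (CutBelow-run α CutBelow-initial runα reach) x∉δ x-ready (y∉xδ ∘ there)
        (Ready-skip ¬feeds y-ready) λ { refl → y∉xδ (here refl) }

module Linearisation {N : Net} {P : Process N} {σ : Word (Net.T N)} (lin : Lin P σ) where
  open Process P using (𝒯; πT; net)
  open Causality P using (Feeds; Ready; Run; initial-or-produced)

  position : 𝒯 → ℕ
  position t = idxℕ σ (proj₁ (proj₂ lin) t)

  position-injective : ∀ {t u} → position t ≡ position u → t ≡ u
  position-injective = proj₁ (proj₁ (proj₂ (proj₂ lin))) ∘ idxℕ-injective σ

  _≟_ : DecidableEquality 𝒯
  t ≟ u = map′ position-injective (cong position) (position t ≟ℕ position u)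

  causal⇒< : ∀ {x y} → Edge⁺ net (inj₂ x) (inj₂ y) → position x < position y
  causal⇒< = proj₂ (proj₂ (proj₂ (proj₂ lin))) _ _

  Feeds⇒< : ∀ {x y} → Feeds x y → position x < position y
  Feeds⇒< (p , xp , py) = causal⇒< (_∷_ {y = inj₁ p} xp [ py ]⁺)

  Sorted : List 𝒯 → Set
  Sorted = AllPairs (λ x y → position x < position y)

  Run-sorted : ∀ {γ} τ → Sorted τ →
               (∀ {x z} → x ∈ τ → z ∈ γ → position z < position x) →
               (∀ {x y} → x ∈ τ → position y < position x → y ∈ γ ⊎ y ∈ τ) →
               Run γ τ
  Run-sorted [] _ _ _ = tt
  Run-sorted {γ} (x ∷ τ) (x< ∷ sorted) γ<τ closed =
    (λ x∈γ → <-irrefl refl (γ<τ (here refl) x∈γ)) , ready ,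
    Run-sorted τ sorted xγ<τ xγ∪τ-closed
    where
    ready : Ready γ x
    ready p px with initial-or-produced p
    ... | inj₁ marked = inj₁ marked
    ... | inj₂ (y , yp) with closed (here refl) (Feeds⇒< (p , yp , px))
    ...   | inj₁ y∈γ = inj₂ (y , y∈γ , yp)
    ...   | inj₂ (here refl) = ⊥-elim (<-irrefl refl (Feeds⇒< (p , yp , px)))
    ...   | inj₂ (there y∈τ) = ⊥-elim (<-asym (Feeds⇒< (p , yp , px)) (All.lookup x< y∈τ))
    xγ<τ : ∀ {x′ z} → x′ ∈ τ → z ∈ x ∷ γ → position z < position x′
    xγ<τ x′∈τ (here refl) = All.lookup x< x′∈τ
    xγ<τ x′∈τ (there z∈γ) = γ<τ (there x′∈τ) z∈γ
    xγ∪τ-closed : ∀ {x′ y} → x′ ∈ τ → position y < position x′ → y ∈ x ∷ γ ⊎ y ∈ τ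
    xγ∪τ-closed x′∈τ y< with closed (there x′∈τ) y<
    ... | inj₁ y∈γ = inj₁ (there y∈γ)
    ... | inj₂ (here refl) = inj₁ (here refl)
    ... | inj₂ (there y∈τ) = inj₂ y∈τ

  tabulate-segment : ∀ {n} (h : Fin n → 𝒯) → (∀ i → position (h i) ≡ toℕ i) →
    Sorted (tabulate h) × Run [] (tabulate h) × (∀ {t} → position t < n → t ∈ tabulate h)
  tabulate-segment {n} h position∘h =
    sorted ,
    Run-sorted (tabulate h) sorted (λ _ ()) (λ x∈τ y<x → inj₂ (contains (<-trans y<x (bounded x∈τ)))) ,
    contains
    where
    sorted : Sorted (tabulate h)
    sorted = AllPairs.tabulate⁺-< λ {i} {j} →
      subst₂ _<_ (sym (position∘h i)) (sym (position∘h j))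
    contains : ∀ {t} → position t < n → t ∈ tabulate h
    contains {t} t<n = subst (_∈ tabulate h)
      (position-injective (trans (position∘h (fromℕ< t<n)) (toℕ-fromℕ< t<n)))
      (∈-tabulate⁺ (fromℕ< t<n))
    bounded : ∀ {x} → x ∈ tabulate h → position x < n
    bounded x∈τ with i , refl ← ∈-tabulate⁻ x∈τ = subst (_< n) (sym (position∘h i)) (toℕ<n i)

module _ {N : Net} {P : Process N} where
  open Process P using (𝒯; πT)
  open Firing N using (FiresInf⇒Fires-takeS)

  initial-segment : ∀ σ (lin : Lin P σ) (ts : List 𝒯) → Σ (List 𝒯) λ τ →
    ts ⊆ τ × Linearisation.Sorted {P = P} {σ} lin τ × Causality.Run P [] τ ×
    fin (map πT τ) ≼ σ × FS N (map πT τ)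
  initial-segment (fin xs) lin@(fires , pos , (_ , surj) , labels , _) _ =
    let sorted , run , contains = Linearisation.tabulate-segment {P = P} lin h (cong toℕ ∘ pos∘h) in
    tabulate h , (λ {t} _ → contains (toℕ<n (pos t))) , sorted , run ,
    ([] , trans (++-identityʳ _) map-πT≡xs) , subst (FS N) (sym map-πT≡xs) fires
    where
    h : Fin (length xs) → 𝒯
    h i = proj₁ (surj i)
    pos∘h : ∀ i → pos (h i) ≡ i
    pos∘h i = proj₂ (surj i) refl
    map-πT≡xs : map πT (tabulate h) ≡ xs
    map-πT≡xs = begin
      map πT (tabulate h)   ≡⟨ map-tabulate h πT ⟩
      tabulate (πT ∘ h)     ≡⟨ tabulate-cong (λ i → trans (labels (h i)) (cong (lookup xs) (pos∘h i))) ⟩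
      tabulate (lookup xs)  ≡⟨ tabulate-lookup xs ⟩
      xs                    ∎
      where open ≡-Reasoning
  initial-segment (inf f) lin@(fires , pos , (_ , surj) , labels , _) ts
    with n , ts<n ← strict-upper-bound pos ts =
    let sorted , run , contains = Linearisation.tabulate-segment {P = P} lin h (pos∘h ∘ toℕ) in
    tabulate h , (λ t∈ts → contains (All.lookup ts<n t∈ts)) , sorted , run ,
    subst (λ τ → fin τ ≼ inf f) (sym map-πT≡takeS) (takeS-≼ f n) ,
    subst (FS N) (sym map-πT≡takeS) (FiresInf⇒Fires-takeS fires n)
    where
    h : Fin n → 𝒯
    h i = proj₁ (surj (toℕ i))
    pos∘h : ∀ i → pos (proj₁ (surj i)) ≡ i
    pos∘h i = proj₂ (surj i) refl
    map-πT≡takeS : map πT (tabulate h) ≡ takeS f n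
    map-πT≡takeS = begin
      map πT (tabulate h)   ≡⟨ map-tabulate h πT ⟩
      tabulate (πT ∘ h)     ≡⟨ tabulate-cong (λ i → trans (labels (h i)) (cong f (pos∘h (toℕ i)))) ⟩
      tabulate (f ∘ toℕ)    ≡⟨ takeS-tabulate f n ⟨
      takeS f n             ∎
      where open ≡-Reasoning

module Prefix {N : Net} {P'' P : Process N} (P''≤P : P'' ≤P P) (finite : FiniteProcess P'')
              (_≟_ : DecidableEquality (Process.𝒯 P)) where
  open _≤P_ P''≤P
  open Process P using (𝒯; 𝓕st; 𝓕ts; πS; πT; pre≤1; π-pre)
  open Causality P using (Feeds; initial-unproduced)

  InPrefix : 𝒯 → Set
  InPrefix x = ∃ λ t → ιT t ≡ x

  InPrefix? : Decidable InPrefix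
  InPrefix? x = let ts , covers = finite in
    map′ Any.satisfied (λ (t , ιt≡x) → lose (covers t) ιt≡x) (any? (λ t → ιT t ≟ x) ts)

  edge-ι : ∀ {a b} → Edge (Process.net P'') a b →
           Edge (Process.net P) (Sum.map ιS ιT a) (Sum.map ιS ιT b)
  edge-ι {inj₁ s} {inj₂ t} e = subst (0 <_) (Fst-restr s t) e
  edge-ι {inj₂ t} {inj₁ s} e = subst (0 <_) (Fts-restr t s) e
  edge-ι {inj₁ _} {inj₁ _} ()
  edge-ι {inj₂ _} {inj₂ _} ()

  Edge⁺-ι : ∀ {a b} → Edge⁺ (Process.net P'') a b →
            Edge⁺ (Process.net P) (Sum.map ιS ιT a) (Sum.map ιS ιT b)
  Edge⁺-ι [ e ]⁺ = [ edge-ι e ]⁺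
  Edge⁺-ι (e ∷ es) = edge-ι e ∷ Edge⁺-ι es

  -- P'' and P give t the same number of preplaces over πS p, so none can lie outside P''.
  preset-in-prefix : ∀ {t p} → 0 < 𝓕st p (ιT t) → ¬ (∀ q → ιS q ≢ p)
  preset-in-prefix {t} {p} pt p∉ι
    with ps'' , ps''! , πps'' , _ , ∑ps''≡ ← Process.π-pre P'' t (πS p) =
    <-irrefl refl (begin-strict
      pre                                       <⟨ +-monoˡ-< pre pt ⟩
      𝓕st p (ιT t) + pre                        ≡⟨ cong (𝓕st p (ιT t) +_) sum-ι ⟨
      sum (map consumption (p ∷ map ιS ps''))   ≤⟨ CardOn⇒sum≤ (π-pre (ιT t) (πS p)) ps! πps ⟩
      pre                                       ∎)
    where
    open ≤-Reasoning
    pre : ℕ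
    pre = Net.Fst N (πS p) (πT (ιT t))
    consumption : Process.𝒮 P → ℕ
    consumption q = 𝓕st q (ιT t)
    ps! : Unique (p ∷ map ιS ps'')
    ps! = All.tabulate (λ q∈ p≡ → let q , _ , ιq≡ = ∈-map⁻ ιS q∈ in
                                  p∉ι q (sym (trans p≡ ιq≡)))
          ∷ map⁺ ιS-inj ps''!
    πps : All (λ q → πS q ≡ πS p) (p ∷ map ιS ps'')
    πps = refl ∷ All.map⁺ (All.map (λ {q} → trans (sym (πS-restr q))) πps'')
    sum-ι : sum (map consumption (map ιS ps'')) ≡ pre
    sum-ι = begin-equality
      sum (map consumption (map ιS ps''))          ≡⟨ cong sum (map-∘ ps'') ⟨
      sum (map (consumption ∘ ιS) ps'')             ≡⟨ cong sum (map-cong (λ q → Fst-restr q t) ps'') ⟨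
      sum (map (λ q → Process.𝓕st P'' q t) ps'')    ≡⟨ ∑ps''≡ ⟩
      Net.Fst N (πS p) (Process.πT P'' t)           ≡⟨ cong (Net.Fst N (πS p)) (πT-restr t) ⟩
      pre                                           ∎

  producer-in-prefix : ∀ {q y} → 0 < 𝓕ts y (ιS q) → InPrefix y
  producer-in-prefix {q} {y} yq with Causality.initial-or-produced P'' q
  ... | inj₁ marked =
    ⊥-elim (<-irrefl (sym (initial-unproduced y (subst (0 <_) (M0-restr q) marked))) yq)
  ... | inj₂ (t , tq) = t , decidable-stable (ιT t ≟ y)
                              (AtMostOne⇒¬≢ (pre≤1 (ιS q)) (subst (0 <_) (Fts-restr t q) tq) yq)

  Feeds-InPrefix : ∀ {y a} → Feeds y a → InPrefix a → InPrefix y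
  Feeds-InPrefix {y} (p , yp , pa) (t , refl) = decidable-stable (InPrefix? y) λ y∉ →
    preset-in-prefix pa λ { q refl → y∉ (producer-in-prefix yp) }

  Lin-from-sorted : ∀ (key : 𝒯 → ℕ) (xs : List 𝒯) → AllPairs (λ a b → key a < key b) xs →
    All InPrefix xs → (∀ t → ιT t ∈ xs) →
    (∀ {a b} → Edge⁺ (Process.net P) (inj₂ a) (inj₂ b) → key a < key b) →
    FS N (map πT xs) → Lin P'' (fin (map πT xs))
  Lin-from-sorted key xs sorted prefix covers causal fires =
    fires , position'' , (injective , surjective) ,
    (λ t → trans (πT-restr t) (sym (lookup-mapIndex πT (covers t)))) ,
    (λ t t' t⇝t' → mapIndex-monotone πT key sorted (covers t) (covers t') (causal (Edge⁺-ι t⇝t')))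
    where
    position'' : Process.𝒯 P'' → Fin (length (map πT xs))
    position'' t = mapIndex πT (covers t)
    injective : ∀ {t t'} → position'' t ≡ position'' t' → t ≡ t'
    injective = ιT-inj ∘ mapIndex-injective πT (covers _) (covers _)
    surjective : ∀ i → ∃ λ t → ∀ {t'} → t' ≡ t → position'' t' ≡ i
    surjective i with x , x∈xs , index≡i ← mapIndex-surjective πT i
                 with t , refl ← All.lookup prefix x∈xs =
      t , λ { refl → trans (cong (mapIndex πT) (unique⇒irrelevant xs! (covers t) x∈xs)) index≡i }
      where
      xs! : Unique xs
      xs! = AllPairs.map (λ a<b a≡b → <-irrefl (cong key a≡b) a<b) sorted

module Sorting {N : Net} (P : Process N) {Q : Pred (Process.𝒯 P) 0ℓ} (Q? : Decidable Q)
               (Q-closed : ∀ {x a} → Causality.Feeds P x a → Q a → Q x) where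
  open Process P using (𝒯; πT)
  open Causality P using (Run; Feeds; swap-independent)

  Valid : List 𝒯 → Set
  Valid τ = Run [] τ × FS N (map πT τ)

  Swaps : List 𝒯 → List 𝒯 → Set
  Swaps τ τ′ = Swap0* N (fin (map πT τ)) (fin (map πT τ′))

  -- Processed prefixes are kept reversed (δ ʳ++ …), so extending one is definitional.
  swap-step : ∀ δ x y β → Valid (δ ʳ++ x ∷ y ∷ β) → ¬ Feeds x y →
              Valid (δ ʳ++ y ∷ x ∷ β) × Swaps (δ ʳ++ y ∷ x ∷ β) (δ ʳ++ x ∷ y ∷ β)
  swap-step δ x y β (run , fires) ¬feeds
    rewrite ʳ++-defn δ {x ∷ y ∷ β} | ʳ++-defn δ {y ∷ x ∷ β}
    with run′ , swap ← swap-independent (reverse δ) x y β run fires ¬feeds =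
    (run′ , proj₁ swap) , swap ◅ ε

  move-forward : ∀ δ αs x ρ → All Q αs → ¬ Q x → Valid (δ ʳ++ x ∷ αs ++ ρ) →
    Valid (δ ʳ++ αs ++ x ∷ ρ) × Swaps (δ ʳ++ αs ++ x ∷ ρ) (δ ʳ++ x ∷ αs ++ ρ)
  move-forward δ [] x ρ _ _ valid = valid , ε
  move-forward δ (a ∷ αs) x ρ (Qa ∷ Qαs) ¬Qx valid =
    let valid₁ , swap = swap-step δ x a (αs ++ ρ) valid (λ feeds → ¬Qx (Q-closed feeds Qa))
        valid₂ , swaps = move-forward (a ∷ δ) αs x ρ Qαs ¬Qx valid₁
    in valid₂ , swaps ◅◅ swap

  partition-by-swaps : ∀ δ τ → Valid (δ ʳ++ τ) →
    Valid (δ ʳ++ filter Q? τ ++ filter (∁? Q?) τ) ×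
    Swaps (δ ʳ++ filter Q? τ ++ filter (∁? Q?) τ) (δ ʳ++ τ)
  partition-by-swaps δ [] valid = valid , ε
  partition-by-swaps δ (x ∷ τ) valid with Q? x
  ... | yes _ = partition-by-swaps (x ∷ δ) τ valid
  ... | no ¬Qx =
    let valid₁ , swaps₁ = partition-by-swaps (x ∷ δ) τ valid
        valid₂ , swaps₂ =
          move-forward δ (filter Q? τ) x (filter (∁? Q?) τ) (All.all-filter Q? τ) ¬Qx valid₁
    in valid₂ , swaps₂ ◅◅ swaps₁

lemma6 : (N : Net) (P'' P : Process N) → FiniteProcess P'' → P'' ≤P P →
    (σ : Word (Net.T N)) → Lin P σ →
    Σ (Word (Net.T N)) λ σ'' → Lin P'' σ'' ×
      Σ (List (Net.T N)) λ σ₁ → Σ (List (Net.T N)) λ σ₂ →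
        FS N σ₁ × FS N σ₂ ×
        σ'' ≼ fin σ₁ × Swap0* N (fin σ₁) (fin σ₂) × fin σ₂ ≼ σ
lemma6 N P'' P finite P''≤P σ lin
  with τ , prefix⊆τ , τ-sorted , τ-run , τ≼σ , τ-fires
         ← initial-segment σ lin (map (_≤P_.ιT P''≤P) (proj₁ finite)) =
  fin (map πT L) ,
  Lin-from-sorted position L (AllPairs.filter⁺ InPrefix? τ-sorted) (All.all-filter InPrefix? τ)
                  covers causal⇒< L-fires ,
  map πT (L ++ R) , map πT τ , LR-fires , τ-fires ,
  (map πT R , sym (map-++ πT L R)) , proj₂ partitioned , τ≼σ
  where
  open Process P using (𝒯; πT)
  open Firing N using (Fires-++⁻ˡ)
  open Linearisation {P = P} {σ} lin using (position; _≟_; causal⇒<)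
  open Prefix P''≤P finite _≟_ using (InPrefix?; Feeds-InPrefix; Lin-from-sorted)
  open Sorting P InPrefix? Feeds-InPrefix using (Valid; Swaps; partition-by-swaps)

  L R : List 𝒯
  L = filter InPrefix? τ
  R = filter (∁? InPrefix?) τ

  partitioned : Valid (L ++ R) × Swaps (L ++ R) τ
  partitioned = partition-by-swaps [] τ (τ-run , τ-fires)

  LR-fires : FS N (map πT (L ++ R))
  LR-fires = proj₂ (proj₁ partitioned)

  L-fires : FS N (map πT L)
  L-fires = Fires-++⁻ˡ (map πT L) (subst (FS N) (map-++ πT L R) LR-fires)

  covers : ∀ t → _≤P_.ιT P''≤P t ∈ L
  covers t = ∈-filter⁺ InPrefix? (prefix⊆τ (∈-map⁺ _ (proj₂ finite t))) (t , refl)
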